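{- For any graph $G$ and any mapping $f: V(G) \to \mathbb{N}$, there is an integer $m_0$ such that if $m \ge m_0$ and $f$ is extended to $G'=G \vee \overline{K_m}$ with $f(v)=|V(G)|$ for every vertex $v$ of $\overline{K_m}$, then $G'$ is not $f$-choosable.
   Context: For graphs $G,H$, the join $G \vee H$ is obtained from the disjoint union of $G$ and $H$ by adding all edges between every vertex of $G$ and every vertex of $H$; $\overline{K_m}$ is the edgeless graph on $m$ vertices. $G$ is $f$-choosable if for every list assignment $L$ with $|L(v)|=f(v)$ there is a proper colouring $\phi$ with $\phi(v)\in L(v)$ for all $v$. -}

module Defs where

open import Data.Nat using (ℕ; _+_)
open import Data.Fin using (Fin; splitAt)
open import Data.Sum using (_⊎_; inj₁; inj₂; [_,_])
open import Data.Product using (Σ; _×_)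
open import Data.Empty using (⊥)
open import Data.Unit using (⊤)
open import Data.List using (List; length)
open import Data.List.Membership.Propositional using (_∈_)
open import Data.List.Relation.Unary.Unique.Propositional using (Unique)
open import Relation.Binary.PropositionalEquality using (_≡_; _≢_)
open import Relation.Nullary using (¬_)

record Graph : Set₁ where
  field
    order  : ℕ
    Adj    : Fin order → Fin order → Set
    sym    : ∀ {u v} → Adj u v → Adj v u
    irrefl : ∀ {v} → ¬ Adj v v
open Graph public

JoinAdj : (G : Graph) (m : ℕ) → Fin (order G) ⊎ Fin m → Fin (order G) ⊎ Fin m → Set
JoinAdj G m (inj₁ u) (inj₁ v) = Adj G u v
JoinAdj G m (inj₁ u) (inj₂ v) = ⊤
JoinAdj G m (inj₂ u) (inj₁ v) = ⊤
JoinAdj G m (inj₂ u) (inj₂ v) = ⊥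

joinSym : (G : Graph) (m : ℕ) → ∀ {u v} → JoinAdj G m u v → JoinAdj G m v u
joinSym G m {inj₁ u} {inj₁ v} a = sym G a
joinSym G m {inj₁ u} {inj₂ v} a = a
joinSym G m {inj₂ u} {inj₁ v} a = a
joinSym G m {inj₂ u} {inj₂ v} ()

joinIrrefl : (G : Graph) (m : ℕ) → ∀ {v} → ¬ JoinAdj G m v v
joinIrrefl G m {inj₁ v} a = irrefl G a
joinIrrefl G m {inj₂ v} ()

join : Graph → ℕ → Graph
join G m = record
  { order  = order G + m
  ; Adj    = λ u v → JoinAdj G m (splitAt (order G) u) (splitAt (order G) v)
  ; sym    = λ {u} {v} → joinSym G m {splitAt (order G) u} {splitAt (order G) v}
  ; irrefl = λ {v} → joinIrrefl G m {splitAt (order G) v}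
  }

extend : (G : Graph) → (Fin (order G) → ℕ) → (m : ℕ) → Fin (order (join G m)) → ℕ
extend G f m x = [ f , (λ _ → order G) ] (splitAt (order G) x)

IsListAssignment : (G : Graph) → (Fin (order G) → ℕ) → (Fin (order G) → List ℕ) → Set
IsListAssignment G f L = ∀ v → Unique (L v) × length (L v) ≡ f v

IsProperLColouring : (G : Graph) → (Fin (order G) → List ℕ) → (Fin (order G) → ℕ) → Set
IsProperLColouring G L φ = (∀ v → φ v ∈ L v) × (∀ u v → Adj G u v → φ u ≢ φ v)

Choosable : (G : Graph) → (Fin (order G) → ℕ) → Set
Choosable G f = ∀ (L : Fin (order G) → List ℕ) → IsListAssignment G f L →
  Σ (Fin (order G) → ℕ) (IsProperLColouring G L)

-- Give each vertex v of G the f(v) colours (v, k), k < f(v), and fix B ≥ max f. A proper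
-- colouring of G picks one colour (v, φ v) at every v, i.e. a choice function φ : Fin n → Fin B.
-- The first Bⁿ vertices of K̄ₘ enumerate all such functions, the vertex of φ receiving the n
-- colours (v, φ v); at the vertex of the choice function picked on G every colour is already
-- taken by a neighbour in G.
module Submission where

open import Defs
open import Data.Nat using (ℕ; suc; _+_; _≤_; _^_; NonZero)
open import Data.Nat.Properties using (≤-trans; m≤m+n; m≤n+m; m≤n⇒m≤1+n; m^n≢0)
open import Data.Nat.DivMod using (_mod_; m<n⇒m%n≡m)
open import Data.Nat.ListAction using (sum)
open import Data.Fin using (Fin; toℕ; splitAt; _↑ˡ_; _↑ʳ_; combine; remQuot; inject≤; finToFun; funToFin)
open import Data.Fin.Properties
  using (toℕ<n; toℕ-injective; toℕ-fromℕ<; toℕ-inject≤; inject≤-injective; splitAt-↑ˡ; splitAt-↑ʳ; remQuot-combine; finToFun-funToFin)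
open import Data.Sum using (_⊎_; inj₁; inj₂; [_,_])
open import Data.Product using (∃; _×_; _,_; proj₁; proj₂)
open import Data.Unit using (tt)
open import Data.List using (List; _∷_; map; tabulate; allFin; length)
open import Data.List.Properties using (length-map; length-tabulate)
open import Data.List.Membership.Propositional using (_∈_)
open import Data.List.Membership.Propositional.Properties using (∈-map⁺; ∈-map⁻; ∈-allFin; ∈-tabulate⁻)
open import Data.List.Relation.Unary.Any using (here; there)
open import Data.List.Relation.Unary.Unique.Propositional using (Unique)
open import Data.List.Relation.Unary.Unique.Propositional.Properties using (map⁺; tabulate⁺; allFin⁺)
open import Relation.Binary.PropositionalEquality
  using (_≡_; refl; trans; cong; subst; subst₂; module ≡-Reasoning)
  renaming (sym to ≡-sym)
open import Relation.Nullary using (¬_)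

∈⇒≤sum : ∀ {x xs} → x ∈ xs → x ≤ sum xs
∈⇒≤sum {xs = x ∷ xs} (here refl) = m≤m+n x (sum xs)
∈⇒≤sum {xs = x ∷ xs} (there x∈xs) = ≤-trans (∈⇒≤sum x∈xs) (m≤n+m (sum xs) x)

toℕ-mod : ∀ {n} .{{_ : NonZero n}} (i : Fin n) → toℕ i mod n ≡ i
toℕ-mod {n} i = toℕ-injective (trans (toℕ-fromℕ< _) (m<n⇒m%n≡m (toℕ<n i)))

encode : ∀ {n b} → Fin n → Fin b → ℕ
encode v k = toℕ (combine v k)

encode-injective : ∀ {n b} {v w : Fin n} {k l : Fin b} →
  encode v k ≡ encode w l → (v , k) ≡ (w , l)
encode-injective {n} {b} {v} {w} {k} {l} eq = begin
  (v , k)                   ≡⟨ ≡-sym (remQuot-combine v k) ⟩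
  remQuot b (combine v k)   ≡⟨ cong (remQuot b) (toℕ-injective eq) ⟩
  remQuot b (combine w l)   ≡⟨ remQuot-combine w l ⟩
  (w , l)                   ∎
  where open ≡-Reasoning

encode-injectiveˡ : ∀ {n b} {v w : Fin n} {k l : Fin b} → encode v k ≡ encode w l → v ≡ w
encode-injectiveˡ {n} {b} eq = cong proj₁ (encode-injective {n} {b} eq)

encode-injectiveʳ : ∀ {n b} {v : Fin n} {k l : Fin b} → encode v k ≡ encode v l → k ≡ l
encode-injectiveʳ {n} {b} eq = cong proj₂ (encode-injective {n} {b} eq)

join-adj : ∀ (G : Graph) m (u : Fin (order G)) (j : Fin m) →
  Adj (join G m) (u ↑ˡ m) (order G ↑ʳ j)
join-adj G m u j =
  subst₂ (JoinAdj G m) (≡-sym (splitAt-↑ˡ (order G) u m)) (≡-sym (splitAt-↑ʳ (order G) m j)) tt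

module Construction (G : Graph) (f : Fin (order G) → ℕ) where

  n : ℕ
  n = order G

  B : ℕ
  B = suc (sum (map f (allFin n)))

  f≤B : ∀ v → f v ≤ B
  f≤B v = m≤n⇒m≤1+n (∈⇒≤sum (∈-map⁺ f (∈-allFin v)))

  instance
    Bⁿ≢0 : NonZero (B ^ n)
    Bⁿ≢0 = m^n≢0 B n

  listG : Fin n → List ℕ
  listG v = tabulate (λ (k : Fin (f v)) → encode v (inject≤ k (f≤B v)))

  -- Vertices beyond Bⁿ repeat lists, which is harmless.
  listK : ∀ m → Fin m → List ℕ
  listK m j = map (λ v → encode v (finToFun (toℕ j mod B ^ n) v)) (allFin n)

  list : ∀ m → Fin n ⊎ Fin m → List ℕ
  list m (inj₁ v) = listG v
  list m (inj₂ j) = listK m j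

  lists : ∀ m → Fin (n + m) → List ℕ
  lists m x = list m (splitAt n x)

  lists-↑ˡ : ∀ m v → lists m (v ↑ˡ m) ≡ listG v
  lists-↑ˡ m v = cong (list m) (splitAt-↑ˡ n v m)

  lists-↑ʳ : ∀ m j → lists m (n ↑ʳ j) ≡ listK m j
  lists-↑ʳ m j = cong (list m) (splitAt-↑ʳ n m j)

  lists-isListAssignment : ∀ m → IsListAssignment (join G m) (extend G f m) (lists m)
  lists-isListAssignment m x = list-isListAssignment (splitAt n x)
    where
    list-isListAssignment : ∀ s → Unique (list m s) × length (list m s) ≡ [ f , (λ _ → n) ] s
    list-isListAssignment (inj₁ v) =
      tabulate⁺ (λ eq → inject≤-injective _ _ _ _ (encode-injectiveʳ {n} {B} eq)) , length-tabulate _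
    list-isListAssignment (inj₂ j) =
      map⁺ (encode-injectiveˡ {n} {B}) (allFin⁺ n) ,
      trans (length-map _ (allFin n)) (length-tabulate _)

  no-proper-colouring : ∀ m → B ^ n ≤ m → ∀ ψ → ¬ IsProperLColouring (join G m) (lists m) ψ
  no-proper-colouring m Bⁿ≤m ψ (ψ∈lists , ψ-proper) = ψ-proper (u ↑ˡ m) (n ↑ʳ j) (join-adj G m u j) clash
    where
    picked : ∀ v → ∃ λ k → ψ (v ↑ˡ m) ≡ encode v (inject≤ k (f≤B v))
    picked v = ∈-tabulate⁻ (subst (ψ (v ↑ˡ m) ∈_) (lists-↑ˡ m v) (ψ∈lists (v ↑ˡ m)))

    φ : Fin n → Fin B
    φ v = inject≤ (proj₁ (picked v)) (f≤B v)

    j : Fin m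
    j = inject≤ (funToFin φ) Bⁿ≤m

    choice-j : ∀ v → finToFun (toℕ j mod B ^ n) v ≡ φ v
    choice-j v = begin
      finToFun (toℕ j mod B ^ n) v              ≡⟨ cong (λ i → finToFun (i mod B ^ n) v) (toℕ-inject≤ _ Bⁿ≤m) ⟩
      finToFun (toℕ (funToFin φ) mod B ^ n) v   ≡⟨ cong (λ c → finToFun c v) (toℕ-mod (funToFin φ)) ⟩
      finToFun (funToFin φ) v                   ≡⟨ finToFun-funToFin φ v ⟩
      φ v                                       ∎
      where open ≡-Reasoning

    seen-at-j : ∃ λ u → u ∈ allFin n × ψ (n ↑ʳ j) ≡ encode u (finToFun (toℕ j mod B ^ n) u)
    seen-at-j = ∈-map⁻ _ (subst (ψ (n ↑ʳ j) ∈_) (lists-↑ʳ m j) (ψ∈lists (n ↑ʳ j)))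

    u : Fin n
    u = proj₁ seen-at-j

    clash : ψ (u ↑ˡ m) ≡ ψ (n ↑ʳ j)
    clash = begin
      ψ (u ↑ˡ m)                                  ≡⟨ proj₂ (picked u) ⟩
      encode u (φ u)                              ≡⟨ cong (encode u) (≡-sym (choice-j u)) ⟩
      encode u (finToFun (toℕ j mod B ^ n) u)     ≡⟨ ≡-sym (proj₂ (proj₂ seen-at-j)) ⟩
      ψ (n ↑ʳ j)                                  ∎
      where open ≡-Reasoning

  not-choosable : ∀ m → B ^ n ≤ m → ¬ Choosable (join G m) (extend G f m)
  not-choosable m Bⁿ≤m choosable =
    no-proper-colouring m Bⁿ≤m _ (proj₂ (choosable (lists m) (lists-isListAssignment m)))

corollary3 : (G : Graph) (f : Fin (order G) → ℕ) →
    ∃ λ m₀ → ∀ m → m₀ ≤ m → ¬ Choosable (join G m) (extend G f m)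
corollary3 G f = B ^ n , not-choosable
  where open Construction G f
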